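{- Every $101$-avoiding ascent sequence $(a_1,\ldots,a_n)$ satisfies $a_k\in[0,a_{k-1}]\cup\{1+\mathsf{asc}(a_1,\ldots,a_{k-1})\}$ for all $k\in(1,n]$; that is, $\mathsf{CAsc}_n\subseteq\mathsf{RAsc}_n$.
   Context: $\mathsf{asc}(a_1,\ldots,a_k)$ is the number of $i\in[1,k)$ with $a_i<a_{i+1}$. An ascent sequence is a sequence $(a_1,\ldots,a_n)$ of non-negative integers with $a_1=0$ and $a_i\le\mathsf{asc}(a_1,\ldots,a_{i-1})+1$ for $1<i\le n$. A sequence contains the pattern $101$ if it has entries $a_i,a_j,a_k$ with $i<j<k$, $a_i=a_k>a_j$; otherwise it is $101$-avoiding. $\mathsf{CAsc}_n$ is the set of $101$-avoiding ascent sequences of length $n$, and $\mathsf{RAsc}_n$ is the set of ascent sequences of length $n$ satisfying the displayed condition for all $k>1$. -}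

module Defs where

open import Data.Nat using (ℕ; zero; suc; _+_; _≤_; _<_; _<ᵇ_)
open import Data.Bool using (if_then_else_)
open import Data.List using (List; []; _∷_; length; take; lookup)
open import Data.Fin using (Fin; toℕ)
open import Data.Product using (Σ; ∃; _×_)
open import Data.Sum using (_⊎_)
open import Relation.Nullary using (¬_)
open import Relation.Binary.PropositionalEquality using (_≡_)

asc : List ℕ → ℕ
asc [] = 0
asc (x ∷ []) = 0
asc (x ∷ y ∷ ys) = (if x <ᵇ y then 1 else 0) + asc (y ∷ ys)

-- Positions are 0-based Fin (length a); position i corresponds to a_{i+1}.
-- take (toℕ i) a is the prefix (a_1,…,a_i) strictly before position i.

record IsAscentSeq (a : List ℕ) : Set where
  field
    first-zero : (i : Fin (length a)) → toℕ i ≡ 0 → lookup a i ≡ 0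
    bound      : (i : Fin (length a)) → 0 < toℕ i →
                 lookup a i ≤ asc (take (toℕ i) a) + 1

Contains101 : List ℕ → Set
Contains101 a = Σ (Fin (length a)) λ i → Σ (Fin (length a)) λ j → Σ (Fin (length a)) λ k →
  (toℕ i < toℕ j) × (toℕ j < toℕ k) ×
  (lookup a i ≡ lookup a k) × (lookup a j < lookup a i)

CAsc : ℕ → List ℕ → Set
CAsc n a = (length a ≡ n) × IsAscentSeq a × ¬ Contains101 a

-- RAsc_n : ascent sequences of length n such that for all k ∈ (1,n]
--   a_k ∈ [0, a_{k-1}] ∪ {1 + asc(a_1,…,a_{k-1})}.
-- Here position k (1-based) is the Fin index k-1, and a_{k-1} is at index k-2.
RAsc : ℕ → List ℕ → Set
RAsc n a = (length a ≡ n) × IsAscentSeq a ×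
  ((i j : Fin (length a)) → suc (toℕ i) ≡ toℕ j →
     (lookup a j ≤ lookup a i) ⊎ (lookup a j ≡ 1 + asc (take (toℕ j) a)))

-- In a 101-avoiding ascent sequence every value 0, …, asc(a₁…aₖ) already
-- occurs in the prefix a₁…aₖ. Hence if aₖ < aₖ₊₁ ≤ 1 + asc(a₁…aₖ) and
-- aₖ₊₁ ≠ 1 + asc(a₁…aₖ), then aₖ₊₁ occurs at some position p ≤ k; p = k is
-- impossible because aₖ < aₖ₊₁, and p < k yields the pattern aₚ aₖ aₖ₊₁ ≅ 101.
-- So an ascent always jumps to 1 + asc, and a non-ascent lies in [0, aₖ].
-- The invariant itself survives each step: a non-ascent leaves asc unchanged,
-- and an ascent raises asc by one while contributing the new value.
module Submission where

open import Defs
open import Data.Nat using (ℕ; zero; suc; _+_; _≤_; _<_; _<ᵇ_; z<s; _<?_)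
open import Data.Nat.Properties
open import Data.Bool using (true; false; T; if_then_else_)
open import Data.List using (List; []; _∷_; length; take; lookup)
open import Data.Fin using (Fin; toℕ; fromℕ<)
import Data.Fin as Fin
open import Data.Fin.Properties using (toℕ-injective; toℕ-fromℕ<; toℕ<n)
open import Data.Product using (∃-syntax; _×_; _,_)
open import Data.Sum using (_⊎_; inj₁; inj₂)
open import Data.Unit using (tt)
open import Relation.Nullary using (¬_; yes; no; contradiction)
open import Function using (_∘′_)
open import Relation.Binary.PropositionalEquality

asc-take-1 : (a : List ℕ) → asc (take 1 a) ≡ 0
asc-take-1 []      = refl
asc-take-1 (x ∷ a) = refl

asc-take-suc : (a : List ℕ) (i j : Fin (length a)) → suc (toℕ i) ≡ toℕ j →
  asc (take (suc (toℕ j)) a) ≡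
  asc (take (toℕ j) a) + (if lookup a i <ᵇ lookup a j then 1 else 0)
asc-take-suc (x ∷ y ∷ a) Fin.zero    (Fin.suc Fin.zero)    refl = +-identityʳ _
asc-take-suc (x ∷ y ∷ a) (Fin.suc i) (Fin.suc (Fin.suc j)) e    =
  trans (cong (_ +_) (asc-take-suc (y ∷ a) i (Fin.suc j) (suc-injective e)))
        (sym (+-assoc (if x <ᵇ y then 1 else 0) _ _))
asc-take-suc (x ∷ y ∷ a) Fin.zero    (Fin.suc (Fin.suc j)) ()
asc-take-suc (x ∷ y ∷ a) (Fin.suc i) (Fin.suc Fin.zero)    ()
asc-take-suc (x ∷ a)     i           Fin.zero              ()
asc-take-suc (x ∷ [])    Fin.zero    (Fin.suc ())          _

OccursBefore : (a : List ℕ) → ℕ → ℕ → Set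
OccursBefore a k v = ∃[ p ] toℕ {length a} p < k × lookup a p ≡ v

OccursBefore-suc : ∀ {a k v} → OccursBefore a k v → OccursBefore a (suc k) v
OccursBefore-suc (p , p<k , ap≡v) = p , m<n⇒m<1+n p<k , ap≡v

Saturated : List ℕ → ℕ → Set
Saturated a k = ∀ {v} → v ≤ asc (take k a) → OccursBefore a k v

ascent-top-not-earlier : (a : List ℕ) → ¬ Contains101 a →
  (i j : Fin (length a)) → suc (toℕ i) ≡ toℕ j → lookup a i < lookup a j →
  ¬ OccursBefore a (toℕ j) (lookup a j)
ascent-top-not-earlier a avoid i j i→j ai<aj (p , p<j , ap≡aj)
  with m<1+n⇒m<n∨m≡n (subst (toℕ p <_) (sym i→j) p<j)
... | inj₁ p<i = avoid (p , i , j , p<i , subst (toℕ i <_) i→j (n<1+n _) , ap≡aj ,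
                        subst (lookup a i <_) (sym ap≡aj) ai<aj)
... | inj₂ p≡i =
  <-irrefl (subst (λ q → lookup a q ≡ lookup a j) (toℕ-injective p≡i) ap≡aj) ai<aj

module _ (a : List ℕ) (ascent : IsAscentSeq a) (avoid : ¬ Contains101 a) where

  open IsAscentSeq ascent

  ascent-is-new-max : (i j : Fin (length a)) → suc (toℕ i) ≡ toℕ j →
    Saturated a (toℕ j) → lookup a i < lookup a j →
    lookup a j ≡ 1 + asc (take (toℕ j) a)
  ascent-is-new-max i j i→j sat ai<aj
    with m≤n⇒m<n∨m≡n (subst (lookup a j ≤_) (+-comm _ 1) (bound j (subst (0 <_) i→j z<s)))
  ... | inj₁ aj<1+asc = contradiction (sat (m<1+n⇒m≤n aj<1+asc))
                                      (ascent-top-not-earlier a avoid i j i→j ai<aj)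
  ... | inj₂ aj≡1+asc = aj≡1+asc

  saturated-first : (i : Fin (length a)) → toℕ i ≡ 0 → Saturated a 1
  saturated-first i i≡0 {v} v≤asc with n≤0⇒n≡0 (subst (v ≤_) (asc-take-1 a) v≤asc)
  ... | refl = i , subst (_< 1) (sym i≡0) z<s , first-zero i i≡0

  saturated-step : (i j : Fin (length a)) → suc (toℕ i) ≡ toℕ j →
    Saturated a (toℕ j) → Saturated a (suc (toℕ j))
  saturated-step i j i→j sat {v} v≤asc
    with lookup a i <ᵇ lookup a j in ai<ᵇaj | asc-take-suc a i j i→j
  ... | false | asc≡ =
    OccursBefore-suc {a} (sat (subst (v ≤_) (trans asc≡ (+-identityʳ _)) v≤asc))
  ... | true  | asc≡ with m≤n⇒m<n∨m≡n (subst (v ≤_) (trans asc≡ (+-comm _ 1)) v≤asc)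
  ...   | inj₁ v<1+asc = OccursBefore-suc {a} (sat (m<1+n⇒m≤n v<1+asc))
  ...   | inj₂ refl  =
    j , n<1+n _ , ascent-is-new-max i j i→j sat (<ᵇ⇒< _ _ (subst T (sym ai<ᵇaj) tt))

  saturated : ∀ k → k < length a → Saturated a (suc k)
  saturated zero    k<n   = saturated-first (fromℕ< k<n) (toℕ-fromℕ< k<n)
  saturated (suc k) 1+k<n =
    subst (Saturated a ∘′ suc) (toℕ-fromℕ< 1+k<n)
      (saturated-step i j i→j
        (subst (Saturated a) (sym (toℕ-fromℕ< 1+k<n)) (saturated k k<n)))
    where
    k<n : k < length a
    k<n = <-trans (n<1+n k) 1+k<n
    i j : Fin (length a)
    i = fromℕ< k<n
    j = fromℕ< 1+k<n
    i→j : suc (toℕ i) ≡ toℕ j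
    i→j = trans (cong suc (toℕ-fromℕ< k<n)) (sym (toℕ-fromℕ< 1+k<n))

  descent-or-new-max : (i j : Fin (length a)) → suc (toℕ i) ≡ toℕ j →
    (lookup a j ≤ lookup a i) ⊎ (lookup a j ≡ 1 + asc (take (toℕ j) a))
  descent-or-new-max i j i→j with lookup a i <? lookup a j
  ... | no  ai≮aj = inj₁ (≮⇒≥ ai≮aj)
  ... | yes ai<aj = inj₂ (ascent-is-new-max i j i→j sat ai<aj)
    where
    sat : Saturated a (toℕ j)
    sat = subst (Saturated a) i→j (saturated (toℕ i) (toℕ<n i))

proposition5p3 : (n : ℕ) (a : List ℕ) → CAsc n a → RAsc n a
proposition5p3 n a (length≡n , ascent , avoid) =
  length≡n , ascent , descent-or-new-max a ascent avoid
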